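{- Let $w_1,w_2\in W$ be words such that $w=w_1e_{AD}w_2$ is admissible. Then \[ f(w)=f(w_1e_{AB}w_2)+f(w_1e_{BD}w_2)+f(w_1w_2). \]
   Context: $W$ is the set of finite words in the six formal letters $e_{AB},e_{AC},e_{AD},e_{BC},e_{BD},e_{CD}$; a letter $e_{uv}$ has first entry $u$ and second entry $v$. A word is admissible if it does not begin with $e_{AB},e_{AC},e_{AD}$ and does not end with $e_{AD},e_{BD},e_{CD}$; $W^0$ is the set of admissible words. For $w=e_{u_1v_1}\cdots e_{u_kv_k}\in W^0$ set $d_j:=\#\{h\geq j\mid u_hv_h\in\{AB,AC,BC\}\}$ (admissibility gives $d_j\geq1$) and \[ f(w):=\sum_{n_1\geq n_2\geq\cdots\geq n_k\geq0}\prod_{j=1}^k\bigl(\varphi_j(u_j)-\varphi_j(v_j)\bigr)\in\mathbb{Q}[[q]], \] where $\varphi_j(A)=1$, $\varphi_j(B)=\varphi_j(C)=0$, $\varphi_j(D)=\dfrac{q^{n_j}}{q^{n_j}-q^{ -d_j}}=-\dfrac{q^{n_j+d_j}}{1-q^{n_j+d_j}}$ (the series converges $q$-adically; $f(\text{empty word})=1$). This is the specialization $A=0$, $B=C=\infty$, $D=1$ of the paper's functional $L_q$. -}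

module Defs where

open import Data.Nat as ℕ using (ℕ; zero; suc; _≤_; _∸_)
open import Data.Nat.Divisibility using (_∣?_)
open import Data.Bool using (Bool; true; false; _∧_; if_then_else_)
open import Data.List using (List; []; _∷_; foldr; map; upTo)
open import Data.Rational using (ℚ; 0ℚ; 1ℚ; _+_; _*_; _-_; -_)
open import Data.Unit using (⊤)
open import Data.Empty using (⊥)
open import Relation.Nullary using (does)

data Vtx : Set where
  A B C D : Vtx

data Letter : Set where
  eAB eAC eAD eBC eBD eCD : Letter

first : Letter → Vtx
first eAB = A
first eAC = A
first eAD = A
first eBC = B
first eBD = B
first eCD = C

second : Letter → Vtx
second eAB = B
second eAC = C
second eAD = D
second eBC = C
second eBD = D
second eCD = D

Word : Set
Word = List Letter

badStart : Letter → Bool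
badStart eAB = true
badStart eAC = true
badStart eAD = true
badStart _   = false

badEnd : Letter → Bool
badEnd eAD = true
badEnd eBD = true
badEnd eCD = true
badEnd _   = false

T : Bool → Set
T true  = ⊤
T false = ⊥

StartOK : Word → Set
StartOK []      = ⊤
StartOK (x ∷ _) = T (Data.Bool.not (badStart x))
  where import Data.Bool

lastOK : Letter → Word → Set
lastOK x []       = T (Data.Bool.not (badEnd x))
  where import Data.Bool
lastOK _ (y ∷ ys) = lastOK y ys

EndOK : Word → Set
EndOK []       = ⊤
EndOK (x ∷ xs) = lastOK x xs

record Admissible (w : Word) : Set where
  field
    startOK : StartOK w
    endOK   : EndOK w

isABC : Letter → Bool
isABC eAB = true
isABC eAC = true
isABC eBC = true
isABC _   = false

-- number of letters in {AB,AC,BC} in a word; d_j = dcount of the suffix from j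
dcount : Word → ℕ
dcount []       = 0
dcount (x ∷ xs) = if isABC x then suc (dcount xs) else dcount xs

-- Formal power series over ℚ in q, as coefficient sequences

Series : Set
Series = ℕ → ℚ

sumℚ : List ℚ → ℚ
sumℚ = foldr _+_ 0ℚ

_⊕_ : Series → Series → Series
(a ⊕ b) n = a n + b n

_⊖_ : Series → Series → Series
(a ⊖ b) n = a n - b n

_⊛_ : Series → Series → Series
(a ⊛ b) n = sumℚ (map (λ i → a i * b (n ∸ i)) (upTo (suc n)))

zeroS : Series
zeroS _ = 0ℚ

oneS : Series
oneS zero    = 1ℚ
oneS (suc _) = 0ℚ

-- q^m/(1 - q^m) = Σ_{t ≥ 1} q^{m t}  (for m ≥ 1): coefficient of q^i is 1
-- iff m ∣ i and i ≥ 1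
geomTail : ℕ → Series
geomTail m zero    = 0ℚ
geomTail m (suc i) = if does (m ∣? suc i) then 1ℚ else 0ℚ

-- φ_j at index n_j = n and d_j = d:
-- φ(A) = 1, φ(B) = φ(C) = 0, φ(D) = - q^{n+d}/(1 - q^{n+d})
φ : ℕ → ℕ → Vtx → Series
φ n d A = oneS
φ n d B = zeroS
φ n d C = zeroS
φ n d D = λ i → - geomTail (n ℕ.+ d) i

factor : Letter → ℕ → ℕ → Series
factor x n d = φ n d (first x) ⊖ φ n d (second x)

-- Σ_{n ≥ ... } over chains bound ≥ n₁ ≥ n₂ ≥ ... ≥ n_k ≥ 0 of the product
-- of factors, where d_j is computed from the suffix starting at letter j.
chainSum : Word → ℕ → Series
chainSum []       bound = oneS
chainSum (x ∷ xs) bound =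
  λ i → sumℚ (map (λ n → (factor x n (dcount (x ∷ xs)) ⊛ chainSum xs n) i)
                  (upTo (suc bound)))

-- partial sum of f(w): all chains with n₁ ≤ M.  f(w) is the q-adic limit
-- of partialF w M as M → ∞ (each coefficient is eventually constant).
partialF : Word → ℕ → Series
partialF w M = chainSum w M

{-# OPTIONS --safe #-}
-- Prepending a letter x acts linearly on truncated chain sums,
-- S ↦ Σ_{n ≤ b} factor x n d ⊛ S n.  Since φ(A) − φ(D) = 1 + (φ(B) − φ(D)),
-- the factor of e_AD is that of e_BD plus 1, and the chains carrying the
-- factor 1 are those of w₁w₂ (the case n_j = n_{j−1}) together with those with
-- n_j < n_{j−1}.  The latter are the chains of w₁e_ABw₂ with every earlier
-- index lowered by one: e_AB raises d_i by one for each earlier letter, and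
-- φ at (n, d + 1) equals φ at (n + 1, d).  So the e_AB-term is the chain sum
-- of w₁e_ABw₂ truncated at M − 1, which agrees with its truncation at M up to
-- O(q^M), as an admissible word starts with e_BC, e_BD or e_CD, whose factor
-- at n₁ = M is O(q^M).
module Submission where

open import Defs
open import Data.Nat using (ℕ; _≤_)
open import Data.List using (_∷_; _++_)
open import Data.Product using (∃-syntax)
open import Data.Rational using (_+_)
open import Relation.Binary.PropositionalEquality using (_≡_)

open import Algebra.Bundles using (CommutativeMonoid)
open import Data.Bool using (true; false; not)
open import Data.Empty using (⊥-elim)
open import Data.List using ([]; [_]; map; upTo)
open import Data.List.Properties using (map-cong; map-++; map-upTo; upTo-∷ʳ)
open import Data.Nat as ℕ using (zero; suc; _<_; _∸_; s≤s)
open import Data.Nat.Divisibility using (_∣?_; ∣⇒≤)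
import Data.Nat.Properties as ℕₚ
open import Data.Product using (_,_)
open import Data.Rational using (ℚ; 0ℚ; 1ℚ; _*_; _-_; -_)
import Data.Rational.Properties as ℚₚ
open import Function using (_∘_)
open import Relation.Nullary using (yes; no)
open import Relation.Binary.PropositionalEquality
  using (_≗_; refl; sym; trans; cong; cong₂; module ≡-Reasoning)

open ≡-Reasoning
open import Algebra.Properties.CommutativeSemigroup
  (CommutativeMonoid.commutativeSemigroup ℚₚ.+-0-commutativeMonoid)
  using (interchange; xy∙z≈xz∙y)

∑< : ℕ → (ℕ → ℚ) → ℚ
∑< n f = sumℚ (map f (upTo n))

syntax ∑< n (λ k → e) = ∑[ k < n ] e

∑<-cong : ∀ n {f g : ℕ → ℚ} → f ≗ g → ∑< n f ≡ ∑< n g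
∑<-cong n f≗g = cong sumℚ (map-cong f≗g (upTo n))

sumℚ-map-+ : ∀ (f g : ℕ → ℚ) xs →
  sumℚ (map (λ k → f k + g k) xs) ≡ sumℚ (map f xs) + sumℚ (map g xs)
sumℚ-map-+ f g []       = refl
sumℚ-map-+ f g (x ∷ xs) =
  trans (cong (f x + g x +_) (sumℚ-map-+ f g xs)) (interchange (f x) (g x) _ _)

∑<-+ : ∀ n (f g : ℕ → ℚ) → ∑[ k < n ] (f k + g k) ≡ ∑< n f + ∑< n g
∑<-+ n f g = sumℚ-map-+ f g (upTo n)

sumℚ-++ : ∀ xs ys → sumℚ (xs ++ ys) ≡ sumℚ xs + sumℚ ys
sumℚ-++ []       ys = sym (ℚₚ.+-identityˡ (sumℚ ys))
sumℚ-++ (x ∷ xs) ys = trans (cong (x +_) (sumℚ-++ xs ys)) (sym (ℚₚ.+-assoc x _ _))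

∑<-suc : ∀ n (f : ℕ → ℚ) → ∑< (suc n) f ≡ ∑< n f + f n
∑<-suc n f = begin
  sumℚ (map f (upTo (suc n)))           ≡⟨ cong (sumℚ ∘ map f) (upTo-∷ʳ n) ⟨
  sumℚ (map f (upTo n ++ [ n ]))        ≡⟨ cong sumℚ (map-++ f (upTo n) [ n ]) ⟩
  sumℚ (map f (upTo n) ++ [ f n ])      ≡⟨ sumℚ-++ (map f (upTo n)) [ f n ] ⟩
  ∑< n f + (f n + 0ℚ)                   ≡⟨ cong (∑< n f +_) (ℚₚ.+-identityʳ (f n)) ⟩
  ∑< n f + f n                          ∎

∑<-sucˡ : ∀ n (f : ℕ → ℚ) → ∑< (suc n) f ≡ f 0 + ∑< n (f ∘ suc)
∑<-sucˡ n f = cong sumℚ (trans (map-upTo f (suc n))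
                               (cong (f 0 ∷_) (sym (map-upTo (f ∘ suc) n))))

∑<-zero : ∀ n (f : ℕ → ℚ) → (∀ k → k < n → f k ≡ 0ℚ) → ∑< n f ≡ 0ℚ
∑<-zero zero    f f≡0 = refl
∑<-zero (suc n) f f≡0 = begin
  ∑< (suc n) f   ≡⟨ ∑<-suc n f ⟩
  ∑< n f + f n   ≡⟨ cong₂ _+_ (∑<-zero n f (λ k k<n → f≡0 k (ℕₚ.m<n⇒m<1+n k<n)))
                              (f≡0 n ℕₚ.≤-refl) ⟩
  0ℚ + 0ℚ        ∎

VanishesBelow : ℕ → Series → Set
VanishesBelow m a = ∀ j → j < m → a j ≡ 0ℚ

⊛-congˡ : ∀ {a a′} (b : Series) → a ≗ a′ → (a ⊛ b) ≗ (a′ ⊛ b)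
⊛-congˡ b a≗a′ i = ∑<-cong (suc i) (λ k → cong (_* b (i ∸ k)) (a≗a′ k))

⊛-congʳ : ∀ (a : Series) {b b′} → b ≗ b′ → (a ⊛ b) ≗ (a ⊛ b′)
⊛-congʳ a b≗b′ i = ∑<-cong (suc i) (λ k → cong (a k *_) (b≗b′ (i ∸ k)))

⊛-distribˡ-⊕ : ∀ (a b c : Series) → ((a ⊕ b) ⊛ c) ≗ ((a ⊛ c) ⊕ (b ⊛ c))
⊛-distribˡ-⊕ a b c i = trans
  (∑<-cong (suc i) (λ k → ℚₚ.*-distribʳ-+ (c (i ∸ k)) (a k) (b k)))
  (∑<-+ (suc i) (λ k → a k * c (i ∸ k)) (λ k → b k * c (i ∸ k)))

⊛-distribʳ-⊕ : ∀ (a b c : Series) → (a ⊛ (b ⊕ c)) ≗ ((a ⊛ b) ⊕ (a ⊛ c))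
⊛-distribʳ-⊕ a b c i = trans
  (∑<-cong (suc i) (λ k → ℚₚ.*-distribˡ-+ (a k) (b (i ∸ k)) (c (i ∸ k))))
  (∑<-+ (suc i) (λ k → a k * b (i ∸ k)) (λ k → a k * c (i ∸ k)))

⊛-zeroʳ : ∀ (a : Series) → (a ⊛ zeroS) ≗ zeroS
⊛-zeroʳ a i = ∑<-zero (suc i) _ (λ k _ → ℚₚ.*-zeroʳ (a k))

⊛-identityˡ : ∀ (a : Series) → (oneS ⊛ a) ≗ a
⊛-identityˡ a i = begin
  (oneS ⊛ a) i                                ≡⟨ ∑<-sucˡ i (λ k → oneS k * a (i ∸ k)) ⟩
  1ℚ * a i + ∑[ k < i ] (0ℚ * a (i ∸ suc k))  ≡⟨ cong₂ _+_ (ℚₚ.*-identityˡ (a i)) tail≡0 ⟩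
  a i + 0ℚ                                    ≡⟨ ℚₚ.+-identityʳ (a i) ⟩
  a i                                         ∎
  where
  tail≡0 : ∑[ k < i ] (0ℚ * a (i ∸ suc k)) ≡ 0ℚ
  tail≡0 = ∑<-zero i _ (λ k _ → ℚₚ.*-zeroˡ (a (i ∸ suc k)))

⊛-vanishesBelowˡ : ∀ {m a} (b : Series) → VanishesBelow m a → VanishesBelow m (a ⊛ b)
⊛-vanishesBelowˡ b a≡0 i i<m = ∑<-zero (suc i) _ λ k k≤i →
  trans (cong (_* b (i ∸ k)) (a≡0 k (ℕₚ.<-≤-trans k≤i i<m))) (ℚₚ.*-zeroˡ (b (i ∸ k)))

geomTail-vanishesBelow : ∀ m → VanishesBelow m (geomTail m)
geomTail-vanishesBelow m zero    _   = refl
geomTail-vanishesBelow m (suc j) j<m with m ∣? suc j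
... | yes m∣j = ⊥-elim (ℕₚ.<⇒≱ j<m (∣⇒≤ m∣j))
... | no  _   = refl

factor-vanishesBelow : ∀ {x} → T (not (badStart x)) →
  ∀ n d → VanishesBelow (n ℕ.+ d) (factor x n d)
factor-vanishesBelow {eBC} _ n d j _   = refl
factor-vanishesBelow {eBD} _ n d j j<m =
  cong (λ z → 0ℚ - (- z)) (geomTail-vanishesBelow (n ℕ.+ d) j j<m)
factor-vanishesBelow {eCD} _ n d j j<m =
  cong (λ z → 0ℚ - (- z)) (geomTail-vanishesBelow (n ℕ.+ d) j j<m)

φ-shift : ∀ n d v → φ n (suc d) v ≗ φ (suc n) d v
φ-shift n d A j = refl
φ-shift n d B j = refl
φ-shift n d C j = refl
φ-shift n d D j = cong (λ m → - geomTail m j) (ℕₚ.+-suc n d)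

factor-shift : ∀ x n d → factor x n (suc d) ≗ factor x (suc n) d
factor-shift x n d j = cong₂ _-_ (φ-shift n d (first x) j) (φ-shift n d (second x) j)

factor-eAB : ∀ n d → factor eAB n d ≗ oneS
factor-eAB n d j = ℚₚ.+-identityʳ (oneS j)

factor-eAD : ∀ n d → factor eAD n d ≗ (oneS ⊕ factor eBD n d)
factor-eAD n d j = cong (oneS j +_) (sym (ℚₚ.+-identityˡ (- - geomTail (n ℕ.+ d) j)))

dcount-++ : ∀ v w → dcount (v ++ w) ≡ dcount v ℕ.+ dcount w
dcount-++ []      w = refl
dcount-++ (x ∷ v) w with isABC x
... | true  = cong suc (dcount-++ v w)
... | false = dcount-++ v w

chainExtend : (ℕ → Series) → (ℕ → Series) → ℕ → Series
chainExtend g S b i = ∑[ n < suc b ] (g n ⊛ S n) i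

below : (ℕ → Series) → ℕ → Series
below S zero    = zeroS
below S (suc b) = S b

chainSum-∷ : ∀ x xs {d} → dcount (x ∷ xs) ≡ d →
  ∀ b → chainSum (x ∷ xs) b ≗ chainExtend (λ n → factor x n d) (chainSum xs) b
chainSum-∷ x xs d≡ b i =
  cong (λ d → chainExtend (λ n → factor x n d) (chainSum xs) b i) d≡

chainExtend-congˡ : ∀ {g h} (S : ℕ → Series) → (∀ n → g n ≗ h n) →
  ∀ b → chainExtend g S b ≗ chainExtend h S b
chainExtend-congˡ S g≗h b i = ∑<-cong (suc b) (λ n → ⊛-congˡ (S n) (g≗h n) i)

chainExtend-congʳ : ∀ g {S T} → (∀ n → S n ≗ T n) →
  ∀ b → chainExtend g S b ≗ chainExtend g T b
chainExtend-congʳ g S≗T b i = ∑<-cong (suc b) (λ n → ⊛-congʳ (g n) (S≗T n) i)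

chainExtend-distribˡ : ∀ g h S b →
  chainExtend (λ n → g n ⊕ h n) S b ≗ (chainExtend g S b ⊕ chainExtend h S b)
chainExtend-distribˡ g h S b i = trans
  (∑<-cong (suc b) (λ n → ⊛-distribˡ-⊕ (g n) (h n) (S n) i))
  (∑<-+ (suc b) (λ n → (g n ⊛ S n) i) (λ n → (h n ⊛ S n) i))

chainExtend-distribʳ : ∀ g S T b →
  chainExtend g (λ n → S n ⊕ T n) b ≗ (chainExtend g S b ⊕ chainExtend g T b)
chainExtend-distribʳ g S T b i = trans
  (∑<-cong (suc b) (λ n → ⊛-distribʳ-⊕ (g n) (S n) (T n) i))
  (∑<-+ (suc b) (λ n → (g n ⊛ S n) i) (λ n → (g n ⊛ T n) i))

chainExtend-identityˡ : ∀ S b i → chainExtend (λ _ → oneS) S b i ≡ ∑[ n < suc b ] S n i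
chainExtend-identityˡ S b i = ∑<-cong (suc b) (λ n → ⊛-identityˡ (S n) i)

chainExtend-below : ∀ g S b →
  chainExtend g (below S) b ≗ below (chainExtend (g ∘ suc) S) b
chainExtend-below g S zero    i = trans (ℚₚ.+-identityʳ _) (⊛-zeroʳ (g 0) i)
chainExtend-below g S (suc b) i = begin
  chainExtend g (below S) (suc b) i
    ≡⟨ ∑<-sucˡ (suc b) (λ n → (g n ⊛ below S n) i) ⟩
  (g 0 ⊛ zeroS) i + chainExtend (g ∘ suc) S b i
    ≡⟨ cong (_+ chainExtend (g ∘ suc) S b i) (⊛-zeroʳ (g 0) i) ⟩
  0ℚ + chainExtend (g ∘ suc) S b i
    ≡⟨ ℚₚ.+-identityˡ _ ⟩
  chainExtend (g ∘ suc) S b i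
    ∎

below-cong : ∀ {S T} → (∀ n → S n ≗ T n) → ∀ b → below S b ≗ below T b
below-cong S≗T zero    i = refl
below-cong S≗T (suc b) i = S≗T b i

chainExtend-factor-below : ∀ x d S b →
  chainExtend (λ n → factor x n d) (below S) b ≗ below (chainExtend (λ n → factor x n (suc d)) S) b
chainExtend-factor-below x d S zero    i = chainExtend-below (λ n → factor x n d) S zero i
chainExtend-factor-below x d S (suc b) i = trans
  (chainExtend-below (λ n → factor x n d) S (suc b) i)
  (chainExtend-congˡ S (λ n j → sym (factor-shift x n d j)) b i)

chainSum-stable : ∀ w → StartOK w →
  ∀ {N M} → N ≤ M → chainSum w (suc M) N ≡ chainSum w M N
chainSum-stable []       _  _   = refl
chainSum-stable (x ∷ xs) ok {N} {M} N≤M = begin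
  chainSum (x ∷ xs) (suc M) N            ≡⟨ ∑<-suc (suc M) chain ⟩
  chainSum (x ∷ xs) M N + chain (suc M)  ≡⟨ cong (chainSum (x ∷ xs) M N +_) top≡0 ⟩
  chainSum (x ∷ xs) M N + 0ℚ             ≡⟨ ℚₚ.+-identityʳ _ ⟩
  chainSum (x ∷ xs) M N                  ∎
  where
  d = dcount (x ∷ xs)
  chain : ℕ → ℚ
  chain n = (factor x n d ⊛ chainSum xs n) N
  top≡0 : chain (suc M) ≡ 0ℚ
  top≡0 = ⊛-vanishesBelowˡ (chainSum xs (suc M)) (factor-vanishesBelow ok (suc M) d)
            N (ℕₚ.m≤n⇒m≤n+o d (s≤s N≤M))

module _ (w₂ : Word) where

  chainSum-eAB-below : ∀ b i →
    ∑[ n < b ] chainSum w₂ n i ≡ below (chainSum (eAB ∷ w₂)) b i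
  chainSum-eAB-below zero    i = refl
  chainSum-eAB-below (suc b) i = sym (begin
    chainSum (eAB ∷ w₂) b i
      ≡⟨ chainExtend-congˡ (chainSum w₂) (λ n → factor-eAB n (dcount (eAB ∷ w₂))) b i ⟩
    chainExtend (λ _ → oneS) (chainSum w₂) b i
      ≡⟨ chainExtend-identityˡ (chainSum w₂) b i ⟩
    ∑[ n < suc b ] chainSum w₂ n i
      ∎)

  chainSum-split-eAD : ∀ u b →
    chainSum (u ++ eAD ∷ w₂) b
      ≗ ((below (chainSum (u ++ eAB ∷ w₂)) b ⊕ chainSum (u ++ eBD ∷ w₂) b)
          ⊕ chainSum (u ++ w₂) b)
  chainSum-split-eAD [] b i = begin
    chainExtend (λ n → factor eAD n d) W b i
      ≡⟨ chainExtend-congˡ W (λ n → factor-eAD n d) b i ⟩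
    chainExtend (λ n → oneS ⊕ factor eBD n d) W b i
      ≡⟨ chainExtend-distribˡ (λ _ → oneS) (λ n → factor eBD n d) W b i ⟩
    chainExtend (λ _ → oneS) W b i + BD
      ≡⟨ cong (_+ BD) (chainExtend-identityˡ W b i) ⟩
    ∑[ n < suc b ] W n i + BD
      ≡⟨ cong (_+ BD) (∑<-suc b (λ n → W n i)) ⟩
    (∑[ n < b ] W n i + W b i) + BD
      ≡⟨ cong (λ z → (z + W b i) + BD) (chainSum-eAB-below b i) ⟩
    (below (chainSum (eAB ∷ w₂)) b i + W b i) + BD
      ≡⟨ xy∙z≈xz∙y (below (chainSum (eAB ∷ w₂)) b i) (W b i) BD ⟩
    (below (chainSum (eAB ∷ w₂)) b i + BD) + W b i
      ∎
    where
    d = dcount w₂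
    W = chainSum w₂
    BD = chainSum (eBD ∷ w₂) b i
  chainSum-split-eAD (x ∷ u) b i = begin
    chainSum (x ∷ u ++ eAD ∷ w₂) b i
      ≡⟨ chainSum-∷ x (u ++ eAD ∷ w₂) (dcount-++ (x ∷ u) (eAD ∷ w₂)) b i ⟩
    chainExtend g (chainSum (u ++ eAD ∷ w₂)) b i
      ≡⟨ chainExtend-congʳ g (chainSum-split-eAD u) b i ⟩
    chainExtend g (λ n → (below AB n ⊕ BD n) ⊕ W n) b i
      ≡⟨ chainExtend-distribʳ g (λ n → below AB n ⊕ BD n) W b i ⟩
    chainExtend g (λ n → below AB n ⊕ BD n) b i + chainExtend g W b i
      ≡⟨ cong (_+ chainExtend g W b i) (chainExtend-distribʳ g (below AB) BD b i) ⟩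
    (chainExtend g (below AB) b i + chainExtend g BD b i) + chainExtend g W b i
      ≡⟨ cong₂ _+_ (cong₂ _+_ extendAB extendBD) extendW ⟩
    (below (chainSum (x ∷ u ++ eAB ∷ w₂)) b i + chainSum (x ∷ u ++ eBD ∷ w₂) b i)
      + chainSum (x ∷ u ++ w₂) b i
      ∎
    where
    d = dcount (x ∷ u) ℕ.+ dcount w₂
    g : ℕ → Series
    g n = factor x n d
    AB BD W : ℕ → Series
    AB = chainSum (u ++ eAB ∷ w₂)
    BD = chainSum (u ++ eBD ∷ w₂)
    W  = chainSum (u ++ w₂)
    extendAB : chainExtend g (below AB) b i ≡ below (chainSum (x ∷ u ++ eAB ∷ w₂)) b i
    extendAB = trans (chainExtend-factor-below x d AB b i)
      (below-cong (λ c j → sym (chainSum-∷ x (u ++ eAB ∷ w₂) dcount-eAB c j)) b i)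
      where
      dcount-eAB : dcount (x ∷ u ++ eAB ∷ w₂) ≡ suc d
      dcount-eAB = trans (dcount-++ (x ∷ u) (eAB ∷ w₂)) (ℕₚ.+-suc _ _)
    extendBD : chainExtend g BD b i ≡ chainSum (x ∷ u ++ eBD ∷ w₂) b i
    extendBD = sym (chainSum-∷ x (u ++ eBD ∷ w₂) (dcount-++ (x ∷ u) (eBD ∷ w₂)) b i)
    extendW : chainExtend g W b i ≡ chainSum (x ∷ u ++ w₂) b i
    extendW = sym (chainSum-∷ x (u ++ w₂) (dcount-++ (x ∷ u) w₂) b i)

lemma4p6 : (w₁ w₂ : Word) → Admissible (w₁ ++ eAD ∷ w₂) →
    (N : ℕ) → ∃[ M₀ ] (∀ M → M₀ ≤ M →
      partialF (w₁ ++ eAD ∷ w₂) M N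
        ≡ partialF (w₁ ++ eAB ∷ w₂) M N
          + partialF (w₁ ++ eBD ∷ w₂) M N
          + partialF (w₁ ++ w₂) M N)
lemma4p6 []         w₂ adm N = ⊥-elim (Admissible.startOK adm)
lemma4p6 w₁@(_ ∷ _) w₂ adm N = suc N , λ where
  (suc M) (s≤s N≤M) →
    let BD = partialF (w₁ ++ eBD ∷ w₂) (suc M) N
        W  = partialF (w₁ ++ w₂) (suc M) N
    in begin
    partialF (w₁ ++ eAD ∷ w₂) (suc M) N
      ≡⟨ chainSum-split-eAD w₂ w₁ (suc M) N ⟩
    partialF (w₁ ++ eAB ∷ w₂) M N + BD + W
      ≡⟨ cong (λ z → z + BD + W) (chainSum-stable (w₁ ++ eAB ∷ w₂) (Admissible.startOK adm) N≤M) ⟨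
    partialF (w₁ ++ eAB ∷ w₂) (suc M) N + BD + W
      ∎
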